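{- Let $k$ and $s$ be positive integers with $s \mid k$, and let $v=1+8k$. Then $\chi'_s(v)=s$, i.e. $s$ is the minimum of $\Omega_s(v)$.
   Context: A $4$-cycle system of order $v$, denoted $4CS(v)$, is a pair $\Sigma=(X,\mathcal B)$ where $X$ is a set of $v$ vertices and $\mathcal B$ is a set of $4$-cycles (called blocks) whose edge sets partition the edge set of the complete graph $K_v$ on $X$; such systems exist iff $v\equiv 1 \pmod 8$. A colouring of $\Sigma$ is a map $\phi\colon\mathcal B\to\mathcal C$ to a set of colours; a $c$-colouring uses exactly $c$ colours. A $c$-colouring of type $s$ is a $c$-colouring such that for every vertex $x$ the blocks containing $x$ receive exactly $s$ distinct colours. $\Omega_s(\Sigma)$ is the set of all $c$ such that $\Sigma$ has a $c$-colouring of type $s$; $\Omega_s(v)=\bigcup_\Sigma\Omega_s(\Sigma)$ over all $4CS(v)$ $\Sigma$; and the lower $s$-chromatic index is $\chi'_s(v)=\min\Omega_s(v)$. -}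

module Defs where

open import Data.Nat using (ℕ; suc; _+_; _*_; _≤_)
open import Data.Fin using (Fin; _≟_)
open import Data.Fin.Properties using (any?)
open import Data.Fin.Subset using (Subset; ∣_∣)
open import Data.Vec using (tabulate)
open import Data.Product using (Σ; ∃; _×_; _,_)
open import Data.Sum using (_⊎_)
open import Relation.Nullary using (¬_; Dec; does)
open import Relation.Nullary.Decidable using (_⊎-dec_; _×-dec_)
open import Relation.Binary.PropositionalEquality using (_≡_; _≢_)

-- A 4-cycle (a,b,c,d) on vertex set Fin v: four distinct vertices,
-- edges {a,b},{b,c},{c,d},{d,a}.
record FourCycle (v : ℕ) : Set where
  constructor cyc
  field
    a b c d : Fin v
    a≢b : a ≢ b
    a≢c : a ≢ c
    a≢d : a ≢ d
    b≢c : b ≢ c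
    b≢d : b ≢ d
    c≢d : c ≢ d
open FourCycle public

SameEdge : {v : ℕ} → Fin v → Fin v → Fin v → Fin v → Set
SameEdge x y u w = (x ≡ u × y ≡ w) ⊎ (x ≡ w × y ≡ u)

EdgeOf : {v : ℕ} → Fin v → Fin v → FourCycle v → Set
EdgeOf x y C = SameEdge x y (a C) (b C) ⊎ SameEdge x y (b C) (c C)
             ⊎ SameEdge x y (c C) (d C) ⊎ SameEdge x y (d C) (a C)

VertexOf : {v : ℕ} → Fin v → FourCycle v → Set
VertexOf x C = x ≡ a C ⊎ x ≡ b C ⊎ x ≡ c C ⊎ x ≡ d C

vertexOf? : {v : ℕ} (x : Fin v) (C : FourCycle v) → Dec (VertexOf x C)
vertexOf? x C = (x ≟ a C) ⊎-dec ((x ≟ b C) ⊎-dec ((x ≟ c C) ⊎-dec (x ≟ d C)))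

record FourCS (v : ℕ) : Set where
  field
    nb     : ℕ
    block  : Fin nb → FourCycle v
    edge-unique : (x y : Fin v) → x ≢ y →
      Σ (Fin nb) λ i → EdgeOf x y (block i) × ((j : Fin nb) → EdgeOf x y (block j) → j ≡ i)
open FourCS public

coloursAt : {v c : ℕ} (Σ' : FourCS v) → (Fin (nb Σ') → Fin c) → Fin v → Subset c
coloursAt Σ' φ x =
  tabulate λ j → does (any? λ i → vertexOf? x (block Σ' i) ×-dec (φ i ≟ j))

IsColouringOfType : {v : ℕ} (Σ' : FourCS v) (c s : ℕ) → (Fin (nb Σ') → Fin c) → Set
IsColouringOfType {v} Σ' c s φ =
  ((j : Fin c) → ∃ λ i → φ i ≡ j) × ((x : Fin v) → ∣ coloursAt Σ' φ x ∣ ≡ s)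

InΩ : (s v c : ℕ) → Set
InΩ s v c = Σ (FourCS v) λ Σ' → Σ (Fin (nb Σ') → Fin c) λ φ → IsColouringOfType Σ' c s φ

LowerChromaticIndex : (s v m : ℕ) → Set
LowerChromaticIndex s v m = InΩ s v m × ((c : ℕ) → InΩ s v c → m ≤ c)

module Submission where

-- Lower bound: in a colouring of type s any single vertex already sees s
-- colours, so at least s colours are used (typeBound).
-- Upper bound: for v = 1 + 8k we build one 4-cycle system with an s-colouring
-- of type s for every 1 ≤ s ≤ k (s ∣ k is only used through s ≤ k).  Its
-- vertices are ∞ and k groups of 8 points.  Each group together with ∞ carries
-- a copy of a 4-cycle system of K₉, and each two groups carry a copy of a
-- 4-cycle decomposition of K₈,₈ (Gluing); the two small decompositions are the
-- cyclic ones mod 9 and mod 8 and are verified by exhaustive computation.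
-- Colouring a block by (an index of) its group mod s, each vertex meets every
-- colour.

open import Defs
open import Data.Nat using (ℕ; suc; _+_; _*_; _%_; _≤_; NonZero)
open import Data.Nat.DivMod using (_mod_; m<n⇒m%n≡m)
open import Data.Nat.Divisibility using (_∣_; ∣⇒≤)
open import Data.Fin using (Fin; zero; suc; toℕ; inject≤; _<_; _≟_)
open import Data.Fin.Properties
  using (all?; any?; <-cmp; <-irrefl; <-asym; <⇒≢; toℕ-injective; toℕ-fromℕ<; toℕ-inject≤; toℕ<n;
         +↔⊎; *↔×; 1↔⊤)
open import Data.Fin.Subset using (∣_∣; _∈_)
open import Data.Fin.Subset.Properties using (∣p∣≤n; ∣⊤∣≡n; ⊆⊤; ⊆-antisym)
open import Data.Vec.Properties using (lookup∘tabulate; lookup⇒[]=)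
open import Data.Empty using (⊥-elim)
open import Data.Product using (∃; _×_; _,_; proj₁)
open import Data.Product.Properties using (≡-dec)
open import Data.Product.Function.NonDependent.Propositional using (_×-↔_)
open import Data.Sum using (_⊎_; inj₁; inj₂; [_,_])
import Data.Sum as Sum
open import Data.Sum.Function.Propositional using (_⊎-↔_)
open import Data.Unit using (⊤; tt)
open import Function using (_∘_)
open import Function.Bundles using (_↔_; Inverse)
open import Function.Properties.Inverse using (↔-refl; ↔-trans)
open import Relation.Binary.Definitions using (DecidableEquality; tri<; tri≈; tri>)
open import Relation.Binary.PropositionalEquality
  using (_≡_; _≢_; refl; sym; trans; cong; subst; subst₂; module ≡-Reasoning)
open import Relation.Nullary using (Dec; yes; no; ¬?)
open import Relation.Nullary.Decidable using (_×-dec_; _⊎-dec_; _→-dec_; map′; from-yes; dec-true)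

-- 4-cycles (v₁ v₂ v₃ v₄) on an arbitrary vertex type, with edges v₁v₂, v₂v₃,
-- v₃v₄, v₄v₁.  Over Fin v the notions below agree definitionally with
-- EdgeOf and VertexOf from Defs.
record Quad (A : Set) : Set where
  constructor quad
  field
    v₁ v₂ v₃ v₄ : A
open Quad

module _ {A : Set} where

  Joins : A → A → A → A → Set
  Joins x y u w = (x ≡ u × y ≡ w) ⊎ (x ≡ w × y ≡ u)

  EdgeIn : A → A → Quad A → Set
  EdgeIn x y Q = Joins x y (v₁ Q) (v₂ Q) ⊎ Joins x y (v₂ Q) (v₃ Q)
               ⊎ Joins x y (v₃ Q) (v₄ Q) ⊎ Joins x y (v₄ Q) (v₁ Q)

  VertexIn : A → Quad A → Set
  VertexIn x Q = x ≡ v₁ Q ⊎ x ≡ v₂ Q ⊎ x ≡ v₃ Q ⊎ x ≡ v₄ Q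

  Distinct : Quad A → Set
  Distinct Q = v₁ Q ≢ v₂ Q × v₁ Q ≢ v₃ Q × v₁ Q ≢ v₄ Q
             × v₂ Q ≢ v₃ Q × v₂ Q ≢ v₄ Q × v₃ Q ≢ v₄ Q

  AllEdges : (A → A → Set) → Quad A → Set
  AllEdges P Q = Both P (v₁ Q) (v₂ Q) × Both P (v₂ Q) (v₃ Q)
               × Both P (v₃ Q) (v₄ Q) × Both P (v₄ Q) (v₁ Q)
    where
    Both : (A → A → Set) → A → A → Set
    Both P u w = P u w × P w u

  allEdges : ∀ {P Q x y} → AllEdges P Q → EdgeIn x y Q → P x y
  allEdges (e₁ , e₂ , e₃ , e₄) = [ joins e₁ , [ joins e₂ , [ joins e₃ , joins e₄ ] ] ]
    where
    joins : ∀ {P : A → A → Set} {u w x y} → P u w × P w u → Joins x y u w → P x y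
    joins (p , _) (inj₁ (refl , refl)) = p
    joins (_ , q) (inj₂ (refl , refl)) = q

module _ {A B : Set} (f : A → B) where

  mapQuad : Quad A → Quad B
  mapQuad Q = quad (f (v₁ Q)) (f (v₂ Q)) (f (v₃ Q)) (f (v₄ Q))

  mapEdge : ∀ {x y Q} → EdgeIn x y Q → EdgeIn (f x) (f y) (mapQuad Q)
  mapEdge = Sum.map joins (Sum.map joins (Sum.map joins joins))
    where
    joins : ∀ {x y u w} → Joins x y u w → Joins (f x) (f y) (f u) (f w)
    joins = Sum.map (λ (p , q) → cong f p , cong f q) (λ (p , q) → cong f p , cong f q)

  mapVertex : ∀ {x Q} → VertexIn x Q → VertexIn (f x) (mapQuad Q)
  mapVertex = Sum.map (cong f) (Sum.map (cong f) (Sum.map (cong f) (cong f)))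

  mapDistinct : (∀ {x y} → f x ≡ f y → x ≡ y) → ∀ {Q} → Distinct Q → Distinct (mapQuad Q)
  mapDistinct inj (d₁ , d₂ , d₃ , d₄ , d₅ , d₆) =
    d₁ ∘ inj , d₂ ∘ inj , d₃ ∘ inj , d₄ ∘ inj , d₅ ∘ inj , d₆ ∘ inj

  mapAllEdges : ∀ {P : A → A → Set} {R : B → B → Set} {Q} →
                (∀ {x y} → P x y → R (f x) (f y)) → AllEdges P Q → AllEdges R (mapQuad Q)
  mapAllEdges g ((a , a′) , (b , b′) , (c , c′) , (d , d′)) =
    (g a , g a′) , (g b , g b′) , (g c , g c′) , (g d , g d′)

module Decide {A : Set} (_≟ₐ_ : DecidableEquality A) where

  joins? : ∀ x y u w → Dec (Joins x y u w)
  joins? x y u w = ((x ≟ₐ u) ×-dec (y ≟ₐ w)) ⊎-dec ((x ≟ₐ w) ×-dec (y ≟ₐ u))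

  edgeIn? : ∀ x y Q → Dec (EdgeIn x y Q)
  edgeIn? x y Q = joins? x y (v₁ Q) (v₂ Q) ⊎-dec joins? x y (v₂ Q) (v₃ Q)
                ⊎-dec joins? x y (v₃ Q) (v₄ Q) ⊎-dec joins? x y (v₄ Q) (v₁ Q)

  distinct? : ∀ Q → Dec (Distinct Q)
  distinct? Q = ¬? (v₁ Q ≟ₐ v₂ Q) ×-dec ¬? (v₁ Q ≟ₐ v₃ Q) ×-dec ¬? (v₁ Q ≟ₐ v₄ Q)
          ×-dec ¬? (v₂ Q ≟ₐ v₃ Q) ×-dec ¬? (v₂ Q ≟ₐ v₄ Q) ×-dec ¬? (v₃ Q ≟ₐ v₄ Q)

  allEdges? : ∀ {P : A → A → Set} → (∀ x y → Dec (P x y)) → ∀ Q → Dec (AllEdges P Q)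
  allEdges? {P} P? Q = both (v₁ Q) (v₂ Q) ×-dec both (v₂ Q) (v₃ Q)
                     ×-dec both (v₃ Q) (v₄ Q) ×-dec both (v₄ Q) (v₁ Q)
    where
    both : ∀ u w → Dec (P u w × P w u)
    both u w = P? u w ×-dec P? w u

  searchOwner : {I : Set} → (∀ {P : I → Set} → (∀ i → Dec (P i)) → Dec (∃ P)) →
                I → (I → Quad A) → A → A → I
  searchOwner search default cycle x y with search (λ i → edgeIn? x y (cycle i))
  ... | yes (i , _) = i
  ... | no _        = default

-- It is presented by an owner function: every edge
-- lies in the block owning it, and every edge of a block is an Adj-edge owned
-- by that block; together these say that the blocks partition the edge set.
record Decomposition (P I : Set) (Adj : P → P → Set) : Set where
  field
    cycle    : I → Quad P
    distinct : ∀ i → Distinct (cycle i)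
    owner    : P → P → I
    covers   : ∀ {x y} → Adj x y → EdgeIn x y (cycle (owner x y))
    owned    : ∀ i → AllEdges (λ x y → Adj x y × owner x y ≡ i) (cycle i)

module Transfer {V B : Set} (D : Decomposition V B _≢_) {v nb : ℕ}
                (vertices : Fin v ↔ V) (blocks : Fin nb ↔ B) where
  open Decomposition D
  private
    module Vtx = Inverse vertices
    module Blk = Inverse blocks

  to-injective : ∀ {x y} → Vtx.to x ≡ Vtx.to y → x ≡ y
  to-injective {x} {y} e =
    trans (sym (Vtx.strictlyInverseʳ x)) (trans (cong Vtx.from e) (Vtx.strictlyInverseʳ y))

  from-injective : ∀ {u w} → Vtx.from u ≡ Vtx.from w → u ≡ w
  from-injective {u} {w} e =
    trans (sym (Vtx.strictlyInverseˡ u)) (trans (cong Vtx.to e) (Vtx.strictlyInverseˡ w))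

  image : B → Quad (Fin v)
  image b = mapQuad Vtx.from (cycle b)

  asFourCycle : (Q : Quad (Fin v)) → Distinct Q → FourCycle v
  asFourCycle (quad a b c d) (a≢b , a≢c , a≢d , b≢c , b≢d , c≢d) = cyc a b c d a≢b a≢c a≢d b≢c b≢d c≢d

  finBlock : Fin nb → FourCycle v
  finBlock n = asFourCycle (image (Blk.to n)) (mapDistinct Vtx.from from-injective (distinct (Blk.to n)))

  numbered : ∀ b → image (Blk.to (Blk.from b)) ≡ image b
  numbered b = cong image (Blk.strictlyInverseˡ b)

  system : FourCS v
  system = record { nb = nb ; block = finBlock ; edge-unique = partition }
    where
    partition : ∀ x y → x ≢ y → ∃ λ n →
                EdgeOf x y (finBlock n) × (∀ n′ → EdgeOf x y (finBlock n′) → n′ ≡ n)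
    partition x y x≢y = Blk.from (owner u w) , contained , unique
      where
      u = Vtx.to x
      w = Vtx.to y
      contained : EdgeOf x y (finBlock (Blk.from (owner u w)))
      contained = subst (EdgeIn x y) (sym (numbered (owner u w)))
        (subst₂ (λ x′ y′ → EdgeIn x′ y′ (image (owner u w)))
                (Vtx.strictlyInverseʳ x) (Vtx.strictlyInverseʳ y)
                (mapEdge Vtx.from (covers (x≢y ∘ to-injective))))
      -- Every edge of the block numbered n′ is owned by block Blk.to n′.
      unique : ∀ n′ → EdgeOf x y (finBlock n′) → n′ ≡ Blk.from (owner u w)
      unique n′ e = sym (allEdges {P = NumberedOwner} (mapAllEdges Vtx.from {R = NumberedOwner} numberOwner (owned (Blk.to n′))) e)
        where
        NumberedOwner : Fin v → Fin v → Set
        NumberedOwner x′ y′ = Blk.from (owner (Vtx.to x′) (Vtx.to y′)) ≡ n′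
        numberOwner : ∀ {u′ w′} → u′ ≢ w′ × owner u′ w′ ≡ Blk.to n′ → NumberedOwner (Vtx.from u′) (Vtx.from w′)
        numberOwner {u′} {w′} (_ , owner≡n′)
          rewrite Vtx.strictlyInverseˡ u′ | Vtx.strictlyInverseˡ w′ | owner≡n′ = Blk.strictlyInverseʳ n′

  colouringOfType : ∀ {s} (colour : B → Fin s) → V →
                    (∀ u c → ∃ λ b → VertexIn u (cycle b) × colour b ≡ c) →
                    InΩ s v s
  colouringOfType {s} colour u₀ sees = system , φ , surjective , seesExactly
    where
    φ : Fin nb → Fin s
    φ = colour ∘ Blk.to
    seen : ∀ x c → ∃ λ n → VertexOf x (finBlock n) × φ n ≡ c
    seen x c with sees (Vtx.to x) c
    ... | b , x∈b , colour≡c =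
      Blk.from b ,
      subst (VertexIn x) (sym (numbered b))
        (subst (λ x′ → VertexIn x′ (image b)) (Vtx.strictlyInverseʳ x) (mapVertex Vtx.from {Q = cycle b} x∈b)) ,
      trans (cong colour (Blk.strictlyInverseˡ b)) colour≡c
    surjective : ∀ c → ∃ λ n → φ n ≡ c
    surjective c with seen (Vtx.from u₀) c
    ... | n , _ , φn≡c = n , φn≡c
    seesExactly : ∀ x → ∣ coloursAt system φ x ∣ ≡ s
    seesExactly x = trans (cong ∣_∣ (⊆-antisym ⊆⊤ (λ {c} _ → member c))) (∣⊤∣≡n s)
      where
      member : ∀ c → c ∈ coloursAt system φ x
      member c = lookup⇒[]= c (coloursAt system φ x) (trans (lookup∘tabulate _ c)
        (dec-true (any? λ n → vertexOf? x (finBlock n) ×-dec (φ n ≟ c)) (seen x c)))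

typeBound : ∀ {s v c} → InΩ s v c → Fin v → s ≤ c
typeBound (Σ′ , φ , _ , seen) x = subst (_≤ _) (seen x) (∣p∣≤n (coloursAt Σ′ φ x))

mod-inject≤ : ∀ {s k} .{{_ : NonZero s}} (s≤k : s ≤ k) (c : Fin s) → toℕ (inject≤ c s≤k) mod s ≡ c
mod-inject≤ {s} s≤k c = toℕ-injective (begin
  toℕ (toℕ (inject≤ c s≤k) mod s) ≡⟨ toℕ-fromℕ< _ ⟩
  toℕ (inject≤ c s≤k) % s          ≡⟨ cong (_% s) (toℕ-inject≤ c s≤k) ⟩
  toℕ c % s                         ≡⟨ m<n⇒m%n≡m (toℕ<n c) ⟩
  toℕ c                             ∎)
  where open ≡-Reasoning

-- The complete bipartite graph K₈,₈: a vertex is a side together with a position.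
data Side : Set where
  low high : Side

opposite : Side → Side
opposite low  = high
opposite high = low

Sided : Set
Sided = Side × Fin 8

Across : Sided → Sided → Set
Across x y = proj₁ x ≢ proj₁ y

-- From a 4-cycle decomposition K₉ of the complete graph on Fin 9 and
-- one, K₈₈, of the complete bipartite graph on Sided, we obtain a decomposition
-- of the complete graph on ∞ plus k groups of 8 points: a copy of K₉ on each
-- group together with ∞, and a copy of K₈₈ between any two groups.
module Gluing (m : ℕ) (K₉ : Decomposition (Fin 9) (Fin 9) _≢_) (K₈₈ : Decomposition Sided Sided Across) where
  module K₉  = Decomposition K₉
  module K₈₈ = Decomposition K₈₈

  k : ℕ
  k = suc m

  Group : Set
  Group = Fin k

  Vertex : Set
  Vertex = ⊤ ⊎ (Fin 8 × Group)

  pattern ∞ = inj₁ tt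
  pattern pt i p = inj₂ (p , i)

  -- For i < j, block (i,j,t) is K₈₈-block (low,t) between groups i and j and
  -- block (j,i,t) is K₈₈-block (high,t) between them; block (i,i,t) is
  -- K₉-block t+1 of group i and block inj₂ i is K₉-block 0 of group i.
  Block : Set
  Block = (Group × Group × Fin 8) ⊎ Group

  inGroup : Group → Fin 9 → Vertex
  inGroup i zero    = ∞
  inGroup i (suc p) = pt i p

  between : Group → Group → Sided → Vertex
  between i j (low  , p) = pt i p
  between i j (high , q) = pt j q

  inGroup-injective : ∀ i {x y} → inGroup i x ≡ inGroup i y → x ≡ y
  inGroup-injective i {zero}  {zero}  _    = refl
  inGroup-injective i {suc p} {suc q} refl = refl

  between-injective : ∀ {i j} → i ≢ j → ∀ {x y} → between i j x ≡ between i j y → x ≡ y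
  between-injective i≢j {low  , p} {low  , q} refl = refl
  between-injective i≢j {high , p} {high , q} refl = refl
  between-injective i≢j {low  , p} {high , q} refl = ⊥-elim (i≢j refl)
  between-injective i≢j {high , p} {low  , q} refl = ⊥-elim (i≢j refl)

  groupIndex : Group → Fin 9 → Block
  groupIndex i zero    = inj₂ i
  groupIndex i (suc t) = inj₁ (i , i , t)

  pairIndex : Group → Group → Sided → Block
  pairIndex i j (low  , t) = inj₁ (i , j , t)
  pairIndex i j (high , t) = inj₁ (j , i , t)

  data BlockView : Block → Set where
    group : ∀ i t → BlockView (groupIndex i t)
    pair  : ∀ {i j} → i < j → ∀ o → BlockView (pairIndex i j o)

  blockView : ∀ b → BlockView b
  blockView (inj₂ i) = group i zero
  blockView (inj₁ (i , j , t)) with <-cmp i j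
  ... | tri< i<j _ _  = pair i<j (low , t)
  ... | tri≈ _ refl _ = group i (suc t)
  ... | tri> _ _ j<i  = pair j<i (high , t)

  cycleOf : ∀ {b} → BlockView b → Quad Vertex
  cycleOf (group i t)          = mapQuad (inGroup i) (K₉.cycle t)
  cycleOf (pair {i} {j} _ o) = mapQuad (between i j) (K₈₈.cycle o)

  blockCycle : Block → Quad Vertex
  blockCycle b = cycleOf (blockView b)

  blockCycle-group : ∀ i t → blockCycle (groupIndex i t) ≡ mapQuad (inGroup i) (K₉.cycle t)
  blockCycle-group i zero = refl
  blockCycle-group i (suc t) with <-cmp i i
  ... | tri< i<i _ _  = ⊥-elim (<-irrefl refl i<i)
  ... | tri≈ _ refl _ = refl
  ... | tri> _ _ i<i  = ⊥-elim (<-irrefl refl i<i)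

  blockCycle-pair : ∀ {i j} → i < j → ∀ o → blockCycle (pairIndex i j o) ≡ mapQuad (between i j) (K₈₈.cycle o)
  blockCycle-pair {i} {j} i<j (low , t) with <-cmp i j
  ... | tri< _ _ _     = refl
  ... | tri≈ _ i≡j _   = ⊥-elim (<⇒≢ i<j i≡j)
  ... | tri> _ _ j<i   = ⊥-elim (<-asym i<j j<i)
  blockCycle-pair {i} {j} i<j (high , t) with <-cmp j i
  ... | tri< j<i _ _   = ⊥-elim (<-asym i<j j<i)
  ... | tri≈ _ j≡i _   = ⊥-elim (<⇒≢ i<j (sym j≡i))
  ... | tri> _ _ _     = refl

  data PairView : Vertex → Vertex → Set where
    inside : ∀ i x y → PairView (inGroup i x) (inGroup i y)
    across : ∀ {i j} → i < j → ∀ {x y} → Across x y → PairView (between i j x) (between i j y)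

  pairView : ∀ u w → PairView u w
  pairView ∞        ∞        = inside zero zero zero
  pairView ∞        (pt i q) = inside i zero (suc q)
  pairView (pt i p) ∞        = inside i (suc p) zero
  pairView (pt i p) (pt j q) with <-cmp i j
  ... | tri< i<j _ _  = across i<j {low , p} {high , q} λ ()
  ... | tri≈ _ refl _ = inside i (suc p) (suc q)
  ... | tri> _ _ j<i  = across j<i {high , p} {low , q} λ ()

  ownerOf : ∀ {u w} → PairView u w → Block
  ownerOf (inside i x y)                = groupIndex i (K₉.owner x y)
  ownerOf (across {i} {j} _ {x} {y} _) = pairIndex i j (K₈₈.owner x y)

  owner : Vertex → Vertex → Block
  owner u w = ownerOf (pairView u w)

  owner-inside : ∀ i {x y} → x ≢ y → owner (inGroup i x) (inGroup i y) ≡ groupIndex i (K₉.owner x y)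
  owner-inside i {zero}  {zero}  x≢y = ⊥-elim (x≢y refl)
  owner-inside i {zero}  {suc q} _   = refl
  owner-inside i {suc p} {zero}  _   = refl
  owner-inside i {suc p} {suc q} _ with <-cmp i i
  ... | tri< i<i _ _  = ⊥-elim (<-irrefl refl i<i)
  ... | tri≈ _ refl _ = refl
  ... | tri> _ _ i<i  = ⊥-elim (<-irrefl refl i<i)

  owner-across : ∀ {i j} → i < j → ∀ {x y} → Across x y →
                 owner (between i j x) (between i j y) ≡ pairIndex i j (K₈₈.owner x y)
  owner-across i<j {low  , _} {low  , _} x↮y = ⊥-elim (x↮y refl)
  owner-across i<j {high , _} {high , _} x↮y = ⊥-elim (x↮y refl)
  owner-across {i} {j} i<j {low , _} {high , _} _ with <-cmp i j
  ... | tri< _ _ _   = refl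
  ... | tri≈ _ i≡j _ = ⊥-elim (<⇒≢ i<j i≡j)
  ... | tri> _ _ j<i = ⊥-elim (<-asym i<j j<i)
  owner-across {i} {j} i<j {high , _} {low , _} _ with <-cmp j i
  ... | tri< j<i _ _ = ⊥-elim (<-asym i<j j<i)
  ... | tri≈ _ j≡i _ = ⊥-elim (<⇒≢ i<j (sym j≡i))
  ... | tri> _ _ _   = refl

  decomposition : Decomposition Vertex Block _≢_
  decomposition = record
    { cycle = blockCycle ; distinct = distinct ; owner = owner
    ; covers = λ {u} {w} → covers (pairView u w) ; owned = λ b → owned (blockView b) }
    where
    distinct : ∀ b → Distinct (blockCycle b)
    distinct b with blockView b
    ... | group i t   = mapDistinct (inGroup i) (inGroup-injective i) (K₉.distinct t)
    ... | pair i<j o  = mapDistinct (between _ _) (between-injective (<⇒≢ i<j)) (K₈₈.distinct o)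

    covers : ∀ {u w} (pv : PairView u w) → u ≢ w → EdgeIn u w (blockCycle (ownerOf pv))
    covers (inside i x y) u≢w =
      subst (EdgeIn _ _) (sym (blockCycle-group i (K₉.owner x y)))
            (mapEdge (inGroup i) (K₉.covers (u≢w ∘ cong (inGroup i))))
    covers (across i<j {x} {y} x↮y) _ =
      subst (EdgeIn _ _) (sym (blockCycle-pair i<j (K₈₈.owner x y)))
            (mapEdge (between _ _) (K₈₈.covers x↮y))

    OwnedBy : Block → Vertex → Vertex → Set
    OwnedBy b u w = u ≢ w × owner u w ≡ b

    owned : ∀ {b} (bv : BlockView b) → AllEdges (OwnedBy b) (cycleOf bv)
    owned (group i t) = mapAllEdges (inGroup i) {R = OwnedBy (groupIndex i t)} {Q = K₉.cycle t} lift (K₉.owned t)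
      where
      lift : ∀ {x y} → x ≢ y × K₉.owner x y ≡ t → OwnedBy (groupIndex i t) (inGroup i x) (inGroup i y)
      lift (x≢y , owned-t) = x≢y ∘ inGroup-injective i , trans (owner-inside i x≢y) (cong (groupIndex i) owned-t)
    owned (pair {i} {j} i<j o) = mapAllEdges (between i j) {R = OwnedBy (pairIndex i j o)} {Q = K₈₈.cycle o} lift (K₈₈.owned o)
      where
      lift : ∀ {x y} → Across x y × K₈₈.owner x y ≡ o → OwnedBy (pairIndex i j o) (between i j x) (between i j y)
      lift (x↮y , owned-o) = (λ e → x↮y (cong proj₁ (between-injective (<⇒≢ i<j) e))) ,
                             trans (owner-across i<j x↮y) (cong (pairIndex i j) owned-o)

  vertices : Fin (1 + 8 * k) ↔ Vertex
  vertices = ↔-trans (+↔⊎ {1} {8 * k}) (1↔⊤ ⊎-↔ *↔× {8} {k})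

  blocks : Fin (k * (k * 8) + k) ↔ Block
  blocks = ↔-trans (+↔⊎ {k * (k * 8)} {k}) (↔-trans (*↔× {k} {k * 8}) (↔-refl ×-↔ *↔× {k} {8}) ⊎-↔ ↔-refl)

  -- Suppose every block of K₉ and of K₈₈ passes through the vertex labelling it.  Then every vertex sees
  -- every colour: point p of group i lies on block (i,j,p) for each j, and ∞ on
  -- block inj₂ j for each j.
  inΩ : (∀ t → VertexIn t (K₉.cycle t)) → (∀ o → VertexIn o (K₈₈.cycle o)) →
        ∀ s .{{_ : NonZero s}} → s ≤ k → InΩ s (1 + 8 * k) s
  inΩ rooted₉ rooted₈₈ s s≤k = Transfer.colouringOfType decomposition vertices blocks colour ∞ seesAll
    where
    colour : Block → Fin s
    colour (inj₁ (_ , j , _)) = toℕ j mod s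
    colour (inj₂ j)           = toℕ j mod s

    startsAt : ∀ i j p → VertexIn (pt i p) (blockCycle (inj₁ (i , j , p)))
    startsAt i j p with <-cmp i j
    ... | tri< _ _ _    = mapVertex (between i j) (rooted₈₈ (low , p))
    ... | tri≈ _ refl _ = mapVertex (inGroup i) (rooted₉ (suc p))
    ... | tri> _ _ _    = mapVertex (between j i) (rooted₈₈ (high , p))

    seesAll : ∀ u c → ∃ λ b → VertexIn u (blockCycle b) × colour b ≡ c
    seesAll ∞        c = inj₂ (inject≤ c s≤k) , mapVertex (inGroup _) (rooted₉ zero) , mod-inject≤ s≤k c
    seesAll (pt i p) c = inj₁ (i , inject≤ c s≤k , p) , startsAt i _ p , mod-inject≤ s≤k c

_⊕_ : ∀ {n} .{{_ : NonZero n}} → Fin n → ℕ → Fin n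
_⊕_ {n} i d = (toℕ i + d) mod n

-- The cyclic 4-cycle system of K₉ on Z₉ developed from the base block
-- (0,1,5,2), whose edges realise each difference ±1, ±2, ±3, ±4 once.
k₉Block : Fin 9 → Quad (Fin 9)
k₉Block t = quad t (t ⊕ 1) (t ⊕ 5) (t ⊕ 2)

open Decide {Fin 9} _≟_ using ()
  renaming (edgeIn? to edgeIn₉?; distinct? to distinct₉?; allEdges? to allEdges₉?; searchOwner to searchOwner₉)

-- Exhaustive verification that the blocks form a 4-cycle system of K₉.  The
-- owner function is kept abstract so that it is only ever computed here.
abstract
  k₉Owner : Fin 9 → Fin 9 → Fin 9
  k₉Owner = searchOwner₉ any? zero k₉Block

  k₉-distinct : ∀ t → Distinct (k₉Block t)
  k₉-distinct = from-yes (all? λ t → distinct₉? (k₉Block t))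

  k₉-covers : ∀ x y → x ≢ y → EdgeIn x y (k₉Block (k₉Owner x y))
  k₉-covers = from-yes (all? λ x → all? λ y → ¬? (x ≟ y) →-dec edgeIn₉? x y (k₉Block (k₉Owner x y)))

  k₉-owned : ∀ t → AllEdges (λ x y → x ≢ y × k₉Owner x y ≡ t) (k₉Block t)
  k₉-owned = from-yes (all? λ t → allEdges₉? (λ x y → ¬? (x ≟ y) ×-dec (k₉Owner x y ≟ t)) (k₉Block t))

k₉-rooted : ∀ t → VertexIn t (k₉Block t)
k₉-rooted _ = inj₁ refl

k₉ : Decomposition (Fin 9) (Fin 9) _≢_
k₉ = record
  { cycle = k₉Block ; distinct = k₉-distinct ; owner = k₉Owner
  ; covers = k₉-covers _ _ ; owned = k₉-owned }

-- Measuring an edge by the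
-- high position minus the low position (mod 8), the low blocks realise the
-- differences {0,1,4,5} and the high blocks the differences {2,3,6,7}.
k₈₈Block : Sided → Quad Sided
k₈₈Block (o , t) = quad (o , t) (opposite o , t ⊕ shift o) (o , t ⊕ 4) (opposite o , t ⊕ (1 + shift o))
  where
  shift : Side → ℕ
  shift low  = 0
  shift high = 1

_≟ₛ_ : DecidableEquality Side
low  ≟ₛ low  = yes refl
low  ≟ₛ high = no λ ()
high ≟ₛ low  = no λ ()
high ≟ₛ high = yes refl

_≟ₚ_ : DecidableEquality Sided
_≟ₚ_ = ≡-dec _≟ₛ_ _≟_

all-sided? : ∀ {n} {P : Side × Fin n → Set} → (∀ x → Dec (P x)) → Dec (∀ x → P x)
all-sided? P? = map′ (λ { (l , h) (low , p) → l p ; (l , h) (high , p) → h p })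
                     (λ all → (λ p → all (low , p)) , (λ p → all (high , p)))
                     (all? (λ p → P? (low , p)) ×-dec all? (λ p → P? (high , p)))

any-sided? : ∀ {n} {P : Side × Fin n → Set} → (∀ x → Dec (P x)) → Dec (∃ P)
any-sided? P? = map′ [ (λ (p , h) → (low , p) , h) , (λ (p , h) → (high , p) , h) ]
                     (λ { ((low , p) , h) → inj₁ (p , h) ; ((high , p) , h) → inj₂ (p , h) })
                     (any? (λ p → P? (low , p)) ⊎-dec any? (λ p → P? (high , p)))

open Decide _≟ₚ_ using ()
  renaming (edgeIn? to edgeInₚ?; distinct? to distinctₚ?; allEdges? to allEdgesₚ?; searchOwner to searchOwnerₚ)

across? : ∀ x y → Dec (Across x y)
across? x y = ¬? (proj₁ x ≟ₛ proj₁ y)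

abstract
  k₈₈Owner : Sided → Sided → Sided
  k₈₈Owner = searchOwnerₚ any-sided? (low , zero) k₈₈Block

  k₈₈-distinct : ∀ o → Distinct (k₈₈Block o)
  k₈₈-distinct = from-yes (all-sided? λ o → distinctₚ? (k₈₈Block o))

  k₈₈-covers : ∀ x y → Across x y → EdgeIn x y (k₈₈Block (k₈₈Owner x y))
  k₈₈-covers = from-yes (all-sided? λ x → all-sided? λ y → across? x y →-dec edgeInₚ? x y (k₈₈Block (k₈₈Owner x y)))

  k₈₈-owned : ∀ o → AllEdges (λ x y → Across x y × k₈₈Owner x y ≡ o) (k₈₈Block o)
  k₈₈-owned = from-yes (all-sided? λ o → allEdgesₚ? (λ x y → across? x y ×-dec (k₈₈Owner x y ≟ₚ o)) (k₈₈Block o))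

k₈₈-rooted : ∀ o → VertexIn o (k₈₈Block o)
k₈₈-rooted _ = inj₁ refl

k₈₈ : Decomposition Sided Sided Across
k₈₈ = record
  { cycle = k₈₈Block ; distinct = k₈₈-distinct ; owner = k₈₈Owner
  ; covers = k₈₈-covers _ _ ; owned = k₈₈-owned }

mainTheorem2 : (k s : ℕ) → 1 ≤ k → 1 ≤ s → s ∣ k →
    LowerChromaticIndex s (1 + 8 * k) s
mainTheorem2 (suc m) s@(suc _) _ _ s∣k =
  Gluing.inΩ m k₉ k₈₈ k₉-rooted k₈₈-rooted s (∣⇒≤ s∣k) , λ c s∈Ωc → typeBound s∈Ωc zero
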